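{- Let $(M,\mathcal{C},\mathcal{C}^*)$ be a Farkas property oriented matroid on $E$. Then the pair $\mathcal{C},\mathcal{C}^*$ has the 4-painting property (4P).
   Context: Matroids are in the sense of Bruhn, Diestel, Kriesell, Pendavingh and Wollan (possibly infinite ground set); cocircuits are circuits of the dual. A signed subset $X$ of $E$ is a support $\underline{X}\subseteq E$ with a partition $(X^+,X^-)$; $-X$ swaps the parts; $X|_A$ has parts $X^\pm\cap A$; $X$ is positive if $\underline{X}=X^+\neq\emptyset$. The reorientation ${}_{ -A}X$ has ${}_{ -A}X^+=(X^+\setminus A)\cup(X^-\cap A)$, ${}_{ -A}X^-=(X^-\setminus A)\cup(X^+\cap A)$, and ${}_{ -A}\mathcal{S}=\{{}_{ -A}X:X\in\mathcal{S}\}$. A circuit signature of $M$ is a set of signed subsets consisting of exactly two opposite signed subsets supported by each circuit; a cocircuit signature is a circuit signature of $M^*$. A pair $\mathcal{S},\mathcal{T}$ of sets of signed subsets of $E'$ has the Farkas property if for every $e\in E'$ exactly one holds: some positive $X\in\mathcal{S}$ has $e\in\underline{X}$, or some positive $Y\in\mathcal{T}$ has $e\in\underline{Y}$. For a minor $N=M/F\setminus G$ with ground set $E(N)$: $\mathcal{S}^{\mathcal{C}}(N)=\{C|_{E(N)}: C\in\mathcal{C},\ \underline{C|_{E(N)}}\text{ a circuit of }N,\ \underline{C}\subseteq E(N)\cup F\}$, $\mathcal{S}^{\mathcal{C}^*}(N)=\{U|_{E(N)}:U\in\mathcal{C}^*,\ \underline{U|_{E(N)}}\text{ a cocircuit of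 }N,\ \underline{U}\subseteq E(N)\cup G\}$. $(M,\mathcal{C},\mathcal{C}^*)$ is Farkas property oriented if for every minor $N$ and every $A\subseteq E(N)$ the pair ${}_{ -A}\mathcal{S}^{\mathcal{C}}(N),{}_{ -A}\mathcal{S}^{\mathcal{C}^*}(N)$ has the Farkas property. A pair $\mathcal{S},\mathcal{T}$ of sets of signed subsets of $E$ has the 4-painting property (4P) if for every partition $E=B\,\dot\cup\,W\,\dot\cup\,G\,\dot\cup\,R$ and every $e\in B\cup W$ exactly one of the following holds: there is $X\in\mathcal{S}$ with $e\in\underline{X}\subseteq B\cup W\cup G$, $\underline{X}\cap B\subseteq X^+$, $\underline{X}\cap W\subseteq X^-$; or there is $Y\in\mathcal{T}$ with $e\in\underline{Y}\subseteq B\cup W\cup R$, $\underline{Y}\cap B\subseteq Y^+$, $\underline{Y}\cap W\subseteq Y^-$. -}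

module Defs where

open import Level using (Level; 0ℓ) renaming (suc to lsuc)
open import Data.Product using (Σ; ∃; ∃-syntax; _×_; _,_)
open import Data.Sum using (_⊎_; inj₁; inj₂)
open import Data.Empty using (⊥)
open import Relation.Nullary using (¬_)
open import Relation.Binary.PropositionalEquality using (_≡_)

Subset : Set → Set₁
Subset U = U → Set

module _ {U : Set} where

  _∈_ : U → Subset U → Set
  x ∈ A = A x

  _⊆_ : Subset U → Subset U → Set
  A ⊆ B = ∀ x → A x → B x

  _≐_ : Subset U → Subset U → Set
  A ≐ B = (A ⊆ B) × (B ⊆ A)

  _⊂_ : Subset U → Subset U → Set
  A ⊂ B = (A ⊆ B) × ¬ (B ⊆ A)

  ∅ : Subset U
  ∅ x = ⊥

  _∪_ : Subset U → Subset U → Subset U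
  (A ∪ B) x = A x ⊎ B x

  _∩_ : Subset U → Subset U → Subset U
  (A ∩ B) x = A x × B x

  _∖_ : Subset U → Subset U → Subset U
  (A ∖ B) x = A x × ¬ B x

  Disjoint : Subset U → Subset U → Set
  Disjoint A B = ∀ x → A x → B x → ⊥

  Nonempty : Subset U → Set
  Nonempty A = ∃[ x ] A x

-- Set systems given by independent sets (Bruhn–Diestel–Kriesell–
-- Pendavingh–Wollan), on a ground set E ⊆ U.

record IndSys (U : Set) : Set₂ where
  field
    ground : Subset U
    Ind    : Subset U → Set₁
open IndSys public

module _ {U : Set} (M : IndSys U) where

  IsBase : Subset U → Set₁
  IsBase I = Ind M I × (∀ J → Ind M J → I ⊆ J → J ⊆ I)

  MaximalBetween : Subset U → Subset U → Subset U → Set₁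
  MaximalBetween I₀ X I =
    (Ind M I × I₀ ⊆ I × I ⊆ X) ×
    (∀ J → Ind M J → I₀ ⊆ J → J ⊆ X → I ⊆ J → J ⊆ I)

  record IsMatroid : Set₁ where
    field
      ind-⊆ground : ∀ I → Ind M I → I ⊆ ground M
      I1 : Ind M ∅
      I2 : ∀ I J → Ind M I → J ⊆ I → Ind M J
      I3 : ∀ I I′ → Ind M I → ¬ IsBase I → IsBase I′ →
           ∃[ x ] ((x ∈ I′ × ¬ (x ∈ I)) × Ind M (λ y → I y ⊎ y ≡ x))
      IM : ∀ I X → Ind M I → I ⊆ X → X ⊆ ground M →
           ∃[ I′ ] MaximalBetween I X I′

  IsCircuit : Subset U → Set₁
  IsCircuit C = (C ⊆ ground M) × ¬ Ind M C × (∀ D → D ⊂ C → Ind M D)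

module _ {U : Set} where

  dual : IndSys U → IndSys U
  ground (dual M) = ground M
  Ind (dual M) I = (I ⊆ ground M) × ∃[ B ] (IsBase M B × Disjoint I B)

  _∖ᵐ_ : IndSys U → Subset U → IndSys U
  ground (M ∖ᵐ X) = ground M ∖ X
  Ind (M ∖ᵐ X) I = Ind M I × (I ⊆ (ground M ∖ X))

  _/ᵐ_ : IndSys U → Subset U → IndSys U
  M /ᵐ X = dual (dual M ∖ᵐ X)

  IsCocircuit : IndSys U → Subset U → Set₁
  IsCocircuit M = IsCircuit (dual M)

  minor : IndSys U → Subset U → Subset U → IndSys U
  minor M F G = (M /ᵐ F) ∖ᵐ G

record Signed (U : Set) : Set₁ where
  field
    pos : Subset U
    neg : Subset U
    disj : Disjoint pos neg
open Signed public

module _ {U : Set} where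

  supp : Signed U → Subset U
  supp X = pos X ∪ neg X

  _≈ˢ_ : Signed U → Signed U → Set
  X ≈ˢ Y = (pos X ≐ pos Y) × (neg X ≐ neg Y)

  -ˢ_ : Signed U → Signed U
  pos (-ˢ X) = neg X
  neg (-ˢ X) = pos X
  disj (-ˢ X) x p n = disj X x n p

  _∣ˢ_ : Signed U → Subset U → Signed U
  pos (X ∣ˢ A) = pos X ∩ A
  neg (X ∣ˢ A) = neg X ∩ A
  disj (X ∣ˢ A) x (p , _) (n , _) = disj X x p n

  Positive : Signed U → Set
  Positive X = (∀ x → ¬ neg X x) × Nonempty (pos X)

  reorient : Subset U → Signed U → Signed U
  pos (reorient A X) = (pos X ∖ A) ∪ (neg X ∩ A)
  neg (reorient A X) = (neg X ∖ A) ∪ (pos X ∩ A)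
  disj (reorient A X) x (inj₁ (p , ¬a)) (inj₁ (n , _)) = disj X x p n
  disj (reorient A X) x (inj₁ (_ , ¬a)) (inj₂ (_ , a)) = ¬a a
  disj (reorient A X) x (inj₂ (_ , a)) (inj₁ (_ , ¬a)) = ¬a a
  disj (reorient A X) x (inj₂ (n , _)) (inj₂ (p , _)) = disj X x p n

  -- sets of signed subsets (taken up to extensional equality of members)
  SignedSet : Set₂
  SignedSet = Signed U → Set₁

  reorientSet : Subset U → SignedSet → SignedSet
  reorientSet A 𝒮 Z = ∃[ X ] (𝒮 X × Z ≈ˢ reorient A X)

  record IsCircuitSignature (M : IndSys U) (𝒞 : SignedSet) : Set₁ where
    field
      supp-circuit : ∀ X → 𝒞 X → IsCircuit M (supp X)
      neg-closed   : ∀ X → 𝒞 X → ∃[ Y ] (𝒞 Y × Y ≈ˢ (-ˢ X))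
      covers       : ∀ C → IsCircuit M C → ∃[ X ] (𝒞 X × supp X ≐ C)
      only-two     : ∀ X Y → 𝒞 X → 𝒞 Y → supp X ≐ supp Y →
                     (Y ≈ˢ X) ⊎ (Y ≈ˢ (-ˢ X))

  IsCocircuitSignature : IndSys U → SignedSet → Set₁
  IsCocircuitSignature M = IsCircuitSignature (dual M)

  ExactlyOne : ∀ {ℓ} → Set ℓ → Set ℓ → Set ℓ
  ExactlyOne P Q = (P ⊎ Q) × ¬ (P × Q)

  FarkasProperty : Subset U → SignedSet → SignedSet → Set₁
  FarkasProperty E′ 𝒮 𝒯 = ∀ e → e ∈ E′ →
    ExactlyOne (∃[ X ] (𝒮 X × Positive X × e ∈ supp X))
               (∃[ Y ] (𝒯 Y × Positive Y × e ∈ supp Y))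

  S𝒞 : IndSys U → SignedSet → Subset U → Subset U → SignedSet
  S𝒞 M 𝒞 F G Z = ∃[ C ] (𝒞 C × Z ≈ˢ (C ∣ˢ EN) ×
                          IsCircuit (minor M F G) (supp (C ∣ˢ EN)) ×
                          supp C ⊆ (EN ∪ F))
    where EN = ground (minor M F G)

  S𝒞* : IndSys U → SignedSet → Subset U → Subset U → SignedSet
  S𝒞* M 𝒞* F G Z = ∃[ D ] (𝒞* D × Z ≈ˢ (D ∣ˢ EN) ×
                          IsCocircuit (minor M F G) (supp (D ∣ˢ EN)) ×
                          supp D ⊆ (EN ∪ G))
    where EN = ground (minor M F G)

  record FarkasOriented (M : IndSys U) (𝒞 𝒞* : SignedSet) : Set₂ where
    field
      matroid : IsMatroid M
      circSig : IsCircuitSignature M 𝒞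
      cocircSig : IsCocircuitSignature M 𝒞*
      farkas : ∀ F G → F ⊆ ground M → G ⊆ ground M → Disjoint F G →
               ∀ A → A ⊆ ground (minor M F G) →
               FarkasProperty (ground (minor M F G))
                 (reorientSet A (S𝒞 M 𝒞 F G)) (reorientSet A (S𝒞* M 𝒞* F G))

  record Partition4 (E B W G R : Subset U) : Set where
    field
      B⊆ : B ⊆ E
      W⊆ : W ⊆ E
      G⊆ : G ⊆ E
      R⊆ : R ⊆ E
      cover : ∀ x → E x → B x ⊎ W x ⊎ G x ⊎ R x
      BW : Disjoint B W
      BG : Disjoint B G
      BR : Disjoint B R
      WG : Disjoint W G
      WR : Disjoint W R
      GR : Disjoint G R

  FourPainting : Subset U → SignedSet → SignedSet → Set₁
  FourPainting E 𝒮 𝒯 = ∀ B W G R → Partition4 E B W G R →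
    ∀ e → e ∈ (B ∪ W) →
    ExactlyOne
      (∃[ X ] (𝒮 X × e ∈ supp X × supp X ⊆ (B ∪ (W ∪ G)) ×
               (supp X ∩ B) ⊆ pos X × (supp X ∩ W) ⊆ neg X))
      (∃[ Y ] (𝒯 Y × e ∈ supp Y × supp Y ⊆ (B ∪ (W ∪ R)) ×
               (supp Y ∩ B) ⊆ pos Y × (supp Y ∩ W) ⊆ neg Y))

-- Existence: reorient the minor M / G ∖ R on W.  Its ground set is B ∪ W, so
-- the Farkas property yields a positive reoriented circuit or cocircuit
-- through e.  Undoing the reorientation turns it into a signed set that is
-- positive on B and negative on W.
--
-- Uniqueness: a circuit C and a cocircuit D painted this way meet only inside
-- B ∪ W.  Reorient all of M on W together with the negative elements of C off
-- D and the negative elements of D off C.  This makes C and D positive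
-- simultaneously, and both pass through e.  That contradicts the Farkas
-- property of the trivial minor M / ∅ ∖ ∅, whose circuits and cocircuits are
-- those of M because M** = M (the one place the matroid axioms are needed).
module Submission where

open import Defs
open import Level using (0ℓ)
open import Axiom.ExcludedMiddle using (ExcludedMiddle)
open import Data.Product using (∃; _×_; _,_; proj₁; proj₂)
open import Data.Sum using (_⊎_; inj₁; inj₂)
open import Data.Empty using (⊥; ⊥-elim)
open import Relation.Nullary using (¬_; yes; no)
open import Relation.Unary using (∁)

module _ {U : Set} where

  SignedBy : Subset U → Subset U → Signed U → Set
  SignedBy P N X = (supp X ∩ P) ⊆ pos X × (supp X ∩ N) ⊆ neg X

  ≈ˢ-refl : {X : Signed U} → X ≈ˢ X
  ≈ˢ-refl = ((λ _ z → z) , (λ _ z → z)) , ((λ _ z → z) , (λ _ z → z))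

  ≈ˢ-sym : {X Y : Signed U} → X ≈ˢ Y → Y ≈ˢ X
  ≈ˢ-sym ((p⊆ , p⊇) , (n⊆ , n⊇)) = (p⊇ , p⊆) , (n⊇ , n⊆)

  supp-resp-≈ˢ : {X Y : Signed U} → X ≈ˢ Y → supp X ⊆ supp Y
  supp-resp-≈ˢ ((p⊆ , _) , _) x (inj₁ p) = inj₁ (p⊆ x p)
  supp-resp-≈ˢ (_ , (n⊆ , _)) x (inj₂ n) = inj₂ (n⊆ x n)

  supp-∣ˢ : (X : Signed U) (A : Subset U) → supp (X ∣ˢ A) ⊆ (supp X ∩ A)
  supp-∣ˢ X A x (inj₁ (p , a)) = inj₁ p , a
  supp-∣ˢ X A x (inj₂ (n , a)) = inj₂ n , a

  supp-∣ˢ⁻ : (X : Signed U) (A : Subset U) → (supp X ∩ A) ⊆ supp (X ∣ˢ A)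
  supp-∣ˢ⁻ X A x (inj₁ p , a) = inj₁ (p , a)
  supp-∣ˢ⁻ X A x (inj₂ n , a) = inj₂ (n , a)

  supp-∣ˢ-≐ : (X : Signed U) {A : Subset U} → supp X ⊆ A → supp (X ∣ˢ A) ≐ supp X
  supp-∣ˢ-≐ X {A} X⊆A =
    (λ x s → proj₁ (supp-∣ˢ X A x s)) , (λ x s → supp-∣ˢ⁻ X A x (s , X⊆A x s))

  supp-reorient : (A : Subset U) (X : Signed U) → supp (reorient A X) ⊆ supp X
  supp-reorient A X x (inj₁ (inj₁ (p , _))) = inj₁ p
  supp-reorient A X x (inj₁ (inj₂ (n , _))) = inj₂ n
  supp-reorient A X x (inj₂ (inj₁ (n , _))) = inj₂ n
  supp-reorient A X x (inj₂ (inj₂ (p , _))) = inj₁ p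

  Positive-resp-≈ˢ : {X Y : Signed U} → X ≈ˢ Y → Positive X → Positive Y
  Positive-resp-≈ˢ ((p⊆ , _) , (_ , n⊇)) (nonneg , x , p) =
    (λ y n → nonneg y (n⊇ y n)) , x , p⊆ x p

  SignedBy-resp-≈ˢ : {P N : Subset U} {X Y : Signed U} →
                     X ≈ˢ Y → SignedBy P N X → SignedBy P N Y
  SignedBy-resp-≈ˢ {X = X} {Y} X≈Y@((p⊆ , _) , (n⊆ , _)) (onP , onN) =
    (λ x (s , p) → p⊆ x (onP x (Y⊆X x s , p))) ,
    (λ x (s , n) → n⊆ x (onN x (Y⊆X x s , n)))
    where
    Y⊆X : supp Y ⊆ supp X
    Y⊆X = supp-resp-≈ˢ {Y} {X} (≈ˢ-sym {X} {Y} X≈Y)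

  SignedBy-mono : {P P′ N N′ : Subset U} {X : Signed U} →
                  P′ ⊆ P → N′ ⊆ N → SignedBy P N X → SignedBy P′ N′ X
  SignedBy-mono P′⊆P N′⊆N (onP , onN) =
    (λ x (s , p) → onP x (s , P′⊆P x p)) , (λ x (s , n) → onN x (s , N′⊆N x n))

  SignedBy-∣ˢ : {P N A : Subset U} (X : Signed U) →
                SignedBy P N (X ∣ˢ A) → SignedBy (P ∩ A) (N ∩ A) X
  SignedBy-∣ˢ {A = A} X (onP , onN) =
    (λ x (s , p , a) → proj₁ (onP x (supp-∣ˢ⁻ X A x (s , a) , p))) ,
    (λ x (s , n , a) → proj₁ (onN x (supp-∣ˢ⁻ X A x (s , a) , n)))

  SignedBy-∣ˢ⁻ : {P N A : Subset U} (X : Signed U) →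
                 SignedBy P N X → SignedBy P N (X ∣ˢ A)
  SignedBy-∣ˢ⁻ {A = A} X (onP , onN) =
    (λ x (s , p) → let s′ , a = supp-∣ˢ X A x s in onP x (s′ , p) , a) ,
    (λ x (s , n) → let s′ , a = supp-∣ˢ X A x s in onN x (s′ , n) , a)

  Positive-reorient⇒SignedBy : {A : Subset U} (X : Signed U) →
                               Positive (reorient A X) → SignedBy (∁ A) A X
  Positive-reorient⇒SignedBy {A} X (nonneg , _) = onP , onN
    where
    onP : (supp X ∩ ∁ A) ⊆ pos X
    onP x (inj₁ p , _)  = p
    onP x (inj₂ n , ¬a) = ⊥-elim (nonneg x (inj₁ (n , ¬a)))
    onN : (supp X ∩ A) ⊆ neg X
    onN x (inj₁ p , a) = ⊥-elim (nonneg x (inj₂ (p , a)))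
    onN x (inj₂ n , _) = n

  reorient-nonnegative : {A : Subset U} (X : Signed U) →
                         SignedBy (∁ A) A X → ∀ x → ¬ neg (reorient A X) x
  reorient-nonnegative X (onP , onN) x (inj₁ (n , ¬a)) =
    disj X x (onP x (inj₂ n , ¬a)) n
  reorient-nonnegative X (onP , onN) x (inj₂ (p , a)) =
    disj X x p (onN x (inj₁ p , a))

  reorient-supp⊆pos : ExcludedMiddle 0ℓ → {A : Subset U} (X : Signed U) →
                      SignedBy (∁ A) A X → supp X ⊆ pos (reorient A X)
  reorient-supp⊆pos lem {A} X (onP , onN) x s with lem {A x}
  ... | yes a = inj₂ (onN x (s , a) , a)
  ... | no ¬a = inj₁ (onP x (s , ¬a) , ¬a)

  reorient-∣ˢ-positive : ExcludedMiddle 0ℓ → {A E′ : Subset U} (X : Signed U) →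
                         SignedBy (∁ A) A X → ∀ {e} → e ∈ (supp X ∩ E′) →
                         Positive (reorient A (X ∣ˢ E′)) × e ∈ supp (reorient A (X ∣ˢ E′))
  reorient-∣ˢ-positive lem {A} {E′} X signedX {e} e∈ =
    (reorient-nonnegative (X ∣ˢ E′) signedX′ , e , e∈pos) , inj₁ e∈pos
    where
    signedX′ : SignedBy (∁ A) A (X ∣ˢ E′)
    signedX′ = SignedBy-∣ˢ⁻ X signedX
    e∈pos : e ∈ pos (reorient A (X ∣ˢ E′))
    e∈pos = reorient-supp⊆pos lem (X ∣ˢ E′) signedX′ e (supp-∣ˢ⁻ X E′ e e∈)

module _ {U : Set} where

  separator : Subset U → Signed U → Signed U → Subset U
  separator W X Y = W ∪ ((neg X ∖ supp Y) ∪ (neg Y ∖ supp X))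

  separator-comm : (W : Subset U) (X Y : Signed U) → separator W Y X ⊆ separator W X Y
  separator-comm W X Y x (inj₁ w)         = inj₁ w
  separator-comm W X Y x (inj₂ (inj₁ n)) = inj₂ (inj₂ n)
  separator-comm W X Y x (inj₂ (inj₂ n)) = inj₂ (inj₁ n)

  module _ (lem : ExcludedMiddle 0ℓ) {B W : Subset U} where

    SignedBy-separator : (X Y : Signed U) → SignedBy B W X →
                         (supp X ∩ supp Y) ⊆ (B ∪ W) →
                         SignedBy (∁ (separator W X Y)) (separator W X Y) X
    SignedBy-separator X Y (onB , onW) X∩Y⊆B∪W = onP , onN
      where
      onP : (supp X ∩ ∁ (separator W X Y)) ⊆ pos X
      onP x (inj₁ p , _) = p
      onP x (inj₂ n , ¬a) with lem {supp Y x}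
      ... | no ¬y = ⊥-elim (¬a (inj₂ (inj₁ (n , ¬y))))
      ... | yes y with X∩Y⊆B∪W x (inj₂ n , y)
      ...   | inj₁ b = ⊥-elim (disj X x (onB x (inj₂ n , b)) n)
      ...   | inj₂ w = ⊥-elim (¬a (inj₁ w))
      onN : (supp X ∩ separator W X Y) ⊆ neg X
      onN x (s , inj₁ w)                = onW x (s , w)
      onN x (_ , inj₂ (inj₁ (n , _)))   = n
      onN x (s , inj₂ (inj₂ (_ , ¬s))) = ⊥-elim (¬s s)

    SignedBy-separatorʳ : (X Y : Signed U) → SignedBy B W Y →
                          (supp X ∩ supp Y) ⊆ (B ∪ W) →
                          SignedBy (∁ (separator W X Y)) (separator W X Y) Y
    SignedBy-separatorʳ X Y signedY X∩Y⊆B∪W =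
      SignedBy-mono {X = Y} (λ x ¬a a → ¬a (separator-comm W X Y x a)) (separator-comm W Y X)
        (SignedBy-separator Y X signedY (λ x (y , s) → X∩Y⊆B∪W x (s , y)))

module _ {U : Set} where

  record _≅ᵐ_ (N M : IndSys U) : Set₁ where
    field
      ground-⊆ : ground N ⊆ ground M
      ground-⊇ : ground M ⊆ ground N
      Ind-to   : ∀ I → Ind N I → Ind M I
      Ind-from : ∀ I → Ind M I → Ind N I
  open _≅ᵐ_

  ≅ᵐ-sym : {N M : IndSys U} → N ≅ᵐ M → M ≅ᵐ N
  ≅ᵐ-sym N≅M = record { ground-⊆ = ground-⊇ N≅M ; ground-⊇ = ground-⊆ N≅M
                      ; Ind-to = Ind-from N≅M ; Ind-from = Ind-to N≅M }

  ≅ᵐ-trans : {N M K : IndSys U} → N ≅ᵐ M → M ≅ᵐ K → N ≅ᵐ K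
  ≅ᵐ-trans N≅M M≅K = record
    { ground-⊆ = λ x z → ground-⊆ M≅K x (ground-⊆ N≅M x z)
    ; ground-⊇ = λ x z → ground-⊇ N≅M x (ground-⊇ M≅K x z)
    ; Ind-to   = λ I z → Ind-to M≅K I (Ind-to N≅M I z)
    ; Ind-from = λ I z → Ind-from N≅M I (Ind-from M≅K I z)
    }

  IsBase-≅ᵐ : {N M : IndSys U} → N ≅ᵐ M → ∀ B → IsBase N B → IsBase M B
  IsBase-≅ᵐ N≅M B (indB , maxB) =
    Ind-to N≅M B indB , λ J indJ B⊆J → maxB J (Ind-from N≅M J indJ) B⊆J

  dual-≅ᵐ : {N M : IndSys U} → N ≅ᵐ M → dual N ≅ᵐ dual M
  dual-≅ᵐ N≅M = record
    { ground-⊆ = ground-⊆ N≅M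
    ; ground-⊇ = ground-⊇ N≅M
    ; Ind-to   = λ I (I⊆ , B , baseB , I#B) →
        (λ x z → ground-⊆ N≅M x (I⊆ x z)) , B , IsBase-≅ᵐ N≅M B baseB , I#B
    ; Ind-from = λ I (I⊆ , B , baseB , I#B) →
        (λ x z → ground-⊇ N≅M x (I⊆ x z)) , B , IsBase-≅ᵐ (≅ᵐ-sym N≅M) B baseB , I#B
    }

  ∖ᵐ∅-≅ᵐ : (M : IndSys U) → (∀ I → Ind M I → I ⊆ ground M) → (M ∖ᵐ ∅) ≅ᵐ M
  ∖ᵐ∅-≅ᵐ M Ind⊆ground = record
    { ground-⊆ = λ x → proj₁
    ; ground-⊇ = λ x z → z , λ ()
    ; Ind-to   = λ I → proj₁
    ; Ind-from = λ I indI → indI , λ x z → Ind⊆ground I indI x z , λ ()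
    }

  dual-downClosed : (M : IndSys U) → ∀ I J → Ind (dual M) I → J ⊆ I → Ind (dual M) J
  dual-downClosed M I J (I⊆ , B , baseB , I#B) J⊆I =
    (λ x z → I⊆ x (J⊆I x z)) , B , baseB , λ x z → I#B x (J⊆I x z)

  base-complement-coindependent : (M : IndSys U) → ∀ B → IsBase M B →
                                  Ind (dual M) (ground M ∖ B)
  base-complement-coindependent M B baseB =
    (λ x → proj₁) , B , baseB , λ x (_ , ¬b) b → ¬b b

  IsCircuit-≅ᵐ : {N M : IndSys U} → N ≅ᵐ M → ∀ C → IsCircuit M C → IsCircuit N C
  IsCircuit-≅ᵐ N≅M C (C⊆ , depC , minC) =
    (λ x z → ground-⊇ N≅M x (C⊆ x z)) ,
    (λ indC → depC (Ind-to N≅M C indC)) ,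
    λ D D⊂C → Ind-from N≅M D (minC D D⊂C)

  IsCircuit-≐ : (M : IndSys U) → (∀ I J → Ind M I → J ⊆ I → Ind M J) →
                ∀ {C D} → D ≐ C → IsCircuit M C → IsCircuit M D
  IsCircuit-≐ M downClosed {C} {D} (D⊆C , C⊆D) (C⊆ , depC , minC) =
    (λ x z → C⊆ x (D⊆C x z)) ,
    (λ indD → depC (downClosed D C indD C⊆D)) ,
    λ D′ (D′⊆D , D⊈D′) →
      minC D′ ((λ x z → D⊆C x (D′⊆D x z)) ,
               λ C⊆D′ → D⊈D′ (λ x z → C⊆D′ x (D⊆C x z)))

  ground⊆trivial-minor : (M : IndSys U) → ground M ⊆ ground (minor M ∅ ∅)
  ground⊆trivial-minor M x ex = (ex , λ ()) , λ ()

  module _ {M : IndSys U} (mat : IsMatroid M) where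
    open IsMatroid mat

    maximal⇒IsBase : ∀ I B → MaximalBetween M I (ground M) B → IsBase M B
    maximal⇒IsBase I B ((indB , I⊆B , _) , maxB) =
      indB , λ J indJ B⊆J →
        maxB J indJ (λ x z → B⊆J x (I⊆B x z)) (ind-⊆ground J indJ) B⊆J

    module _ (lem : ExcludedMiddle 0ℓ) where

      base-complement-cobase : ∀ B → IsBase M B → IsBase (dual M) (ground M ∖ B)
      base-complement-cobase B baseB =
        base-complement-coindependent M B baseB , maxB∁
        where
        maxB∁ : ∀ J → Ind (dual M) J → (ground M ∖ B) ⊆ J → J ⊆ (ground M ∖ B)
        maxB∁ J (J⊆ , B₂ , baseB₂ , J#B₂) B∁⊆J y jy =
          J⊆ y jy , λ by → J#B₂ y jy (proj₂ baseB₂ B (proj₁ baseB) B₂⊆B y by)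
          where
          B₂⊆B : B₂ ⊆ B
          B₂⊆B z b₂z with lem {B z}
          ... | yes bz = bz
          ... | no ¬bz =
            ⊥-elim (J#B₂ z (B∁⊆J z (ind-⊆ground B₂ (proj₁ baseB₂) z b₂z , ¬bz)) b₂z)

      dual-involutive : dual (dual M) ≅ᵐ M
      dual-involutive = record
        { ground-⊆ = λ x z → z
        ; ground-⊇ = λ x z → z
        ; Ind-to   = to
        ; Ind-from = from
        }
        where
        to : ∀ I → Ind (dual (dual M)) I → Ind M I
        to I (I⊆ , B′ , ((B′⊆ , B , baseB , B′#B) , maxB′) , I#B′) =
          I2 B I (proj₁ baseB) I⊆B
          where
          B∁⊆B′ : (ground M ∖ B) ⊆ B′
          B∁⊆B′ = maxB′ (ground M ∖ B) (base-complement-coindependent M B baseB)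
                        (λ y b′y → B′⊆ y b′y , B′#B y b′y)
          I⊆B : I ⊆ B
          I⊆B x ix with lem {B x}
          ... | yes bx = bx
          ... | no ¬bx = ⊥-elim (I#B′ x ix (B∁⊆B′ x (I⊆ x ix , ¬bx)))
        from : ∀ I → Ind M I → Ind (dual (dual M)) I
        from I indI with IM I (ground M) indI (ind-⊆ground I indI) (λ _ z → z)
        ... | B , maximalB@((_ , I⊆B , _) , _) =
          ind-⊆ground I indI , ground M ∖ B ,
          base-complement-cobase B (maximal⇒IsBase I B maximalB) ,
          λ y iy (_ , ¬by) → ¬by (I⊆B y iy)

      trivial-minor-≅ᵐ : minor M ∅ ∅ ≅ᵐ M
      trivial-minor-≅ᵐ =
        ≅ᵐ-trans (∖ᵐ∅-≅ᵐ (M /ᵐ ∅) (λ I → proj₁))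
          (≅ᵐ-trans (dual-≅ᵐ (∖ᵐ∅-≅ᵐ (dual M) (λ I → proj₁))) dual-involutive)

      IsCircuit-trivial-minor : (X : Signed U) → IsCircuit M (supp X) →
                                IsCircuit (minor M ∅ ∅) (supp (X ∣ˢ ground (minor M ∅ ∅)))
      IsCircuit-trivial-minor X circX =
        IsCircuit-≅ᵐ trivial-minor-≅ᵐ _
          (IsCircuit-≐ M I2
            (supp-∣ˢ-≐ X (λ x s → ground⊆trivial-minor M x (proj₁ circX x s))) circX)

      IsCocircuit-trivial-minor : (X : Signed U) → IsCocircuit M (supp X) →
                                  IsCocircuit (minor M ∅ ∅) (supp (X ∣ˢ ground (minor M ∅ ∅)))
      IsCocircuit-trivial-minor X cocircX =
        IsCircuit-≅ᵐ (dual-≅ᵐ trivial-minor-≅ᵐ) _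
          (IsCircuit-≐ (dual M) (dual-downClosed M)
            (supp-∣ˢ-≐ X (λ x s → ground⊆trivial-minor M x (proj₁ cocircX x s))) cocircX)

Painted : {U : Set} → SignedSet {U} → (B W O : Subset U) → U → Signed U → Set₁
Painted 𝒮 B W O e X = 𝒮 X × e ∈ supp X × supp X ⊆ (B ∪ (W ∪ O)) × SignedBy B W X

module _ {U : Set} {E B W G R : Subset U} (part : Partition4 E B W G R) where
  open Partition4 part

  B⊆E∖G∖R : B ⊆ ((E ∖ G) ∖ R)
  B⊆E∖G∖R x b = (B⊆ x b , BG x b) , BR x b

  W⊆E∖G∖R : W ⊆ ((E ∖ G) ∖ R)
  W⊆E∖G∖R x w = (W⊆ x w , WG x w) , WR x w

  E∖G∖R⊆B∪W : ((E ∖ G) ∖ R) ⊆ (B ∪ W)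
  E∖G∖R⊆B∪W x ((ex , ¬g) , ¬r) with cover x ex
  ... | inj₁ b                = inj₁ b
  ... | inj₂ (inj₁ w)         = inj₂ w
  ... | inj₂ (inj₂ (inj₁ g))  = ⊥-elim (¬g g)
  ... | inj₂ (inj₂ (inj₂ r))  = ⊥-elim (¬r r)

  B∪W∪G∩B∪W∪R⊆B∪W : ((B ∪ (W ∪ G)) ∩ (B ∪ (W ∪ R))) ⊆ (B ∪ W)
  B∪W∪G∩B∪W∪R⊆B∪W x (inj₁ b , _)                    = inj₁ b
  B∪W∪G∩B∪W∪R⊆B∪W x (inj₂ (inj₁ w) , _)             = inj₂ w
  B∪W∪G∩B∪W∪R⊆B∪W x (inj₂ (inj₂ g) , inj₁ b)        = ⊥-elim (BG x b g)
  B∪W∪G∩B∪W∪R⊆B∪W x (inj₂ (inj₂ g) , inj₂ (inj₁ w)) = ⊥-elim (WG x w g)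
  B∪W∪G∩B∪W∪R⊆B∪W x (inj₂ (inj₂ g) , inj₂ (inj₂ r)) = ⊥-elim (GR x g r)

module _ {U : Set} {M : IndSys U} {𝒞 𝒞* : SignedSet {U}} (fo : FarkasOriented M 𝒞 𝒞*)
         {B W G R : Subset U} (part : Partition4 (ground M) B W G R) where
  open Partition4 part
  open FarkasOriented fo

  private
    EN : Subset U
    EN = ground (minor M G R)

  Painted-unreorient : {O : Subset U} (C Z X : Signed U) {e : U} →
    Z ≈ˢ (C ∣ˢ EN) → X ≈ˢ reorient W Z → Positive X → e ∈ supp X →
    supp C ⊆ (EN ∪ O) → e ∈ supp C × supp C ⊆ (B ∪ (W ∪ O)) × SignedBy B W C
  Painted-unreorient {O} C Z X {e} Z≈C∣EN X≈Z↺ positiveX e∈X C⊆EN∪O =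
    e∈C , C⊆B∪W∪O , SignedBy-mono {X = C} B⊆∁W∩EN W⊆W∩EN signedC
    where
    signedC : SignedBy (∁ W ∩ EN) (W ∩ EN) C
    signedC = SignedBy-∣ˢ C (SignedBy-resp-≈ˢ {X = Z} {C ∣ˢ EN} Z≈C∣EN
      (Positive-reorient⇒SignedBy Z
        (Positive-resp-≈ˢ {X = X} {Y = reorient W Z} X≈Z↺ positiveX)))
    B⊆∁W∩EN : B ⊆ (∁ W ∩ EN)
    B⊆∁W∩EN x b = BW x b , B⊆E∖G∖R part x b
    W⊆W∩EN : W ⊆ (W ∩ EN)
    W⊆W∩EN x w = w , W⊆E∖G∖R part x w
    e∈C : e ∈ supp C
    e∈C = proj₁ (supp-∣ˢ C EN e (supp-resp-≈ˢ {X = Z} {Y = C ∣ˢ EN} Z≈C∣EN e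
            (supp-reorient W Z e (supp-resp-≈ˢ {X = X} {Y = reorient W Z} X≈Z↺ e e∈X))))
    C⊆B∪W∪O : supp C ⊆ (B ∪ (W ∪ O))
    C⊆B∪W∪O x s with C⊆EN∪O x s
    ... | inj₂ o = inj₂ (inj₂ o)
    ... | inj₁ en with E∖G∖R⊆B∪W part x en
    ...   | inj₁ b = inj₁ b
    ...   | inj₂ w = inj₂ (inj₁ w)

  painted-exists : ∀ e → e ∈ (B ∪ W) → ∃ (Painted 𝒞 B W G e) ⊎ ∃ (Painted 𝒞* B W R e)
  painted-exists e e∈B∪W
    with proj₁ (farkas G R G⊆ R⊆ GR W (W⊆E∖G∖R part) e (B∪W⊆EN e e∈B∪W))
    where
    B∪W⊆EN : (B ∪ W) ⊆ EN
    B∪W⊆EN x (inj₁ b) = B⊆E∖G∖R part x b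
    B∪W⊆EN x (inj₂ w) = W⊆E∖G∖R part x w
  ... | inj₁ (X , (Z , (C , C∈ , Z≈ , _ , C⊆) , X≈) , positiveX , e∈X) =
    inj₁ (C , C∈ , Painted-unreorient C Z X Z≈ X≈ positiveX e∈X C⊆)
  ... | inj₂ (X , (Z , (D , D∈ , Z≈ , _ , D⊆) , X≈) , positiveX , e∈X) =
    inj₂ (D , D∈ , Painted-unreorient D Z X Z≈ X≈ positiveX e∈X D⊆)

module _ (lem : ExcludedMiddle 0ℓ) {U : Set} {M : IndSys U} {𝒞 𝒞* : SignedSet {U}}
         (fo : FarkasOriented M 𝒞 𝒞*)
         {B W G R : Subset U} (part : Partition4 (ground M) B W G R) where
  open Partition4 part
  open FarkasOriented fo

  no-painted-pair : ∀ {e C D} → Painted 𝒞 B W G e C → Painted 𝒞* B W R e D → ⊥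
  no-painted-pair {e} {C} {D} (C∈ , e∈C , C⊆ , signedC) (D∈ , e∈D , D⊆ , signedD) =
    proj₂ (farkas ∅ ∅ (λ _ ()) (λ _ ()) (λ _ ()) A A⊆EN e (into e (C⊆E e e∈C)))
      ( (reorient A (C ∣ˢ EN) , reoriented-C , C-positive)
      , (reorient A (D ∣ˢ EN) , reoriented-D , D-positive) )
    where
    EN : Subset U
    EN = ground (minor M ∅ ∅)
    A : Subset U
    A = separator W C D
    into : ground M ⊆ EN
    into = ground⊆trivial-minor M
    circC : IsCircuit M (supp C)
    circC = IsCircuitSignature.supp-circuit circSig C C∈
    cocircD : IsCocircuit M (supp D)
    cocircD = IsCircuitSignature.supp-circuit cocircSig D D∈
    C⊆E : supp C ⊆ ground M
    C⊆E = proj₁ circC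
    D⊆E : supp D ⊆ ground M
    D⊆E = proj₁ cocircD
    C∩D⊆B∪W : (supp C ∩ supp D) ⊆ (B ∪ W)
    C∩D⊆B∪W x (c , d) = B∪W∪G∩B∪W∪R⊆B∪W part x (C⊆ x c , D⊆ x d)
    A⊆EN : A ⊆ EN
    A⊆EN x (inj₁ w)                = into x (W⊆ x w)
    A⊆EN x (inj₂ (inj₁ (n , _)))   = into x (C⊆E x (inj₂ n))
    A⊆EN x (inj₂ (inj₂ (n , _)))   = into x (D⊆E x (inj₂ n))
    reoriented-C : reorientSet A (S𝒞 M 𝒞 ∅ ∅) (reorient A (C ∣ˢ EN))
    reoriented-C =
      C ∣ˢ EN ,
      (C , C∈ , ≈ˢ-refl {X = C ∣ˢ EN} , IsCircuit-trivial-minor matroid lem C circC ,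
       λ x s → inj₁ (into x (C⊆E x s))) ,
      ≈ˢ-refl {X = reorient A (C ∣ˢ EN)}
    reoriented-D : reorientSet A (S𝒞* M 𝒞* ∅ ∅) (reorient A (D ∣ˢ EN))
    reoriented-D =
      D ∣ˢ EN ,
      (D , D∈ , ≈ˢ-refl {X = D ∣ˢ EN} , IsCocircuit-trivial-minor matroid lem D cocircD ,
       λ x s → inj₁ (into x (D⊆E x s))) ,
      ≈ˢ-refl {X = reorient A (D ∣ˢ EN)}
    C-positive : Positive (reorient A (C ∣ˢ EN)) × e ∈ supp (reorient A (C ∣ˢ EN))
    C-positive = reorient-∣ˢ-positive lem C (SignedBy-separator lem C D signedC C∩D⊆B∪W)
                   (e∈C , into e (C⊆E e e∈C))
    D-positive : Positive (reorient A (D ∣ˢ EN)) × e ∈ supp (reorient A (D ∣ˢ EN))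
    D-positive = reorient-∣ˢ-positive lem D (SignedBy-separatorʳ lem C D signedD C∩D⊆B∪W)
                   (e∈D , into e (D⊆E e e∈D))

lemma5p9 : (lem : ∀ {ℓ} → ExcludedMiddle ℓ) →
           {U : Set} (M : IndSys U) (𝒞 𝒞* : SignedSet {U}) →
           FarkasOriented M 𝒞 𝒞* →
           FourPainting (ground M) 𝒞 𝒞*
lemma5p9 lem M 𝒞 𝒞* fo B W G R part e e∈B∪W =
  painted-exists fo part e e∈B∪W ,
  λ ((C , paintedC) , (D , paintedD)) → no-painted-pair lem fo part paintedC paintedD
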